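{- Let $\mathcal C$ be a class of graphs and $m,\Delta,k:\mathbb N\to\mathbb N$ functions such that every $n$-vertex graph $G\in\mathcal C$ admits a merge sequence of length at most $m(n)$, valency at most $\Delta(n)$, and radius-$1$ width at most $k(n)$. Then $\mathcal C$ admits a labelling scheme of length $O(m(n)\cdot k(n)\cdot\log\Delta(n))$.
   Context: Graphs are finite, simple, undirected. For a partition $\mathcal P$ of $V(G)$ and $X\subseteq V(G)$, $X/\mathcal P$ is the set of parts intersecting $X$. For $R\subseteq\binom{V(G)}2$, $\mathrm{Ball}^r_R(v)$ is the radius-$r$ ball in $(V(G),R)$. $\mathcal P$ is homogeneous modulo $R$ if for all parts $X,Y$ (possibly equal), the pairs $\{x,y\}$, $x\in X,y\in Y,x\ne y$, not in $R$ are all edges of $G$ or all non-edges. A merge sequence for $G$ is $(\mathcal P_1,R_1),\dots,(\mathcal P_m,R_m)$ with $\mathcal P_1\preceq\dots\preceq\mathcal P_m$ partitions of $V(G)$, $\mathcal P_1$ into singletons, $\mathcal P_m=\{V(G)\}$, $R_1\subseteq\dots\subseteq R_m$, $\mathcal P_t$ homogeneous modulo $R_t$; its length is $m$; its radius-$r$ width is $\max_{t<m}\max_v|\mathrm{Ball}^r_{R_{t+1}}(v)/\mathcal P_t|$; its valency is the least $\Delta$ such that for every $i\in[m-1]$ every part of $\mathcal P_{i+1}$ is a union of at most $\Delta$ parts of $\mathcal P_i$. A labelling scheme for $\mathcal C$ is a pair of functions: an encoder assigning to each $G\in\mathcal C$ and $u\in V(G)$ a binary word $\mathcal E_G(u)$,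 and a decoder mapping pairs of binary words to accept/reject, such that for all $G\in\mathcal C$ and distinct $u,v\in V(G)$, $uv\in E(G)$ iff the decoder accepts $(\mathcal E_G(u),\mathcal E_G(v))$. Its length is $\ell(n)=\max\{|\mathcal E_G(u)|:G\in\mathcal C,|V(G)|=n,u\in V(G)\}$; no computability is required. -}

module Defs where

open import Data.Nat using (ℕ; zero; suc; _+_; _*_; _∸_; _≤_; _<_)
open import Data.Nat.Logarithm using (⌈log₂_⌉)
open import Data.Bool using (Bool; true; false; _∨_; _∧_; if_then_else_)
open import Data.Fin using (Fin; _≟_)
import Data.Fin as F
open import Data.List using (List; length)
open import Data.Product using (Σ; ∃; ∃-syntax; _×_; _,_)
open import Relation.Nullary using (¬_)
open import Relation.Nullary.Decidable using (⌊_⌋)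
open import Relation.Binary.PropositionalEquality using (_≡_; _≢_)
open import Function.Bundles using (_⇔_)

anyF : ∀ {n} → (Fin n → Bool) → Bool
anyF {zero}  f = false
anyF {suc n} f = f F.zero ∨ anyF (λ i → f (F.suc i))

countF : ∀ {n} → (Fin n → Bool) → ℕ
countF {zero}  f = 0
countF {suc n} f = (if f F.zero then 1 else 0) + countF (λ i → f (F.suc i))

record Graph (n : ℕ) : Set where
  field
    adj     : Fin n → Fin n → Bool
    symm    : ∀ x y → adj x y ≡ adj y x
    irrefl  : ∀ x → adj x x ≡ false
open Graph public

GraphClass : Set₁
GraphClass = ∀ {n} → Graph n → Set

-- Partitions of Fin n are represented by a part-labelling p : Fin n → Fin n
-- (x and y lie in the same part iff p x ≡ p y).
-- Sets R of unordered pairs of distinct vertices are represented by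
-- symmetric irreflexive Boolean relations.

Partition : ℕ → Set
Partition n = Fin n → Fin n

PairSet : ℕ → Set
PairSet n = Fin n → Fin n → Bool

inBall : ∀ {n} → PairSet n → ℕ → Fin n → Fin n → Bool
inBall R zero    v w = ⌊ v ≟ w ⌋
inBall R (suc r) v w = inBall R r v w ∨ anyF (λ u → inBall R r v u ∧ R u w)

-- |X / P| for X given by a membership test: the number of parts of P
-- intersecting X (parts identified by their labels).
partsMeeting : ∀ {n} → Partition n → (Fin n → Bool) → ℕ
partsMeeting p X = countF (λ ℓ → anyF (λ w → X w ∧ ⌊ p w ≟ ℓ ⌋))

Homogeneous : ∀ {n} → Graph n → Partition n → PairSet n → Set
Homogeneous G p R =
  ∀ x y x' y' → p x ≡ p x' → p y ≡ p y' → x ≢ y → x' ≢ y' →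
  R x y ≡ false → R x' y' ≡ false → adj G x y ≡ adj G x' y'

-- Merge sequences.  The paper's (P_1,R_1),…,(P_m,R_m) is stored 0-indexed:
-- (part t, rel t) for t = 0,…,len-1; values at t ≥ len are irrelevant.

record MergeSeq {n : ℕ} (G : Graph n) : Set where
  field
    len        : ℕ
    part       : ℕ → Partition n
    rel        : ℕ → PairSet n
    len≥1      : 1 ≤ len
    rel-symm   : ∀ t → t < len → ∀ x y → rel t x y ≡ rel t y x
    rel-irrefl : ∀ t → t < len → ∀ x → rel t x x ≡ false
    refines    : ∀ t → suc t < len → ∀ x y →
                 part t x ≡ part t y → part (suc t) x ≡ part (suc t) y
    rel-mono   : ∀ t → suc t < len → ∀ x y →
                 rel t x y ≡ true → rel (suc t) x y ≡ true
    first-singletons : ∀ x y → part 0 x ≡ part 0 y → x ≡ y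
    last-whole       : ∀ x y → part (len ∸ 1) x ≡ part (len ∸ 1) y
    homogeneous      : ∀ t → t < len → Homogeneous G (part t) (rel t)
open MergeSeq public

WidthAtMost : ∀ {n} {G : Graph n} → MergeSeq G → ℕ → ℕ → Set
WidthAtMost S r k =
  ∀ t → suc t < len S → ∀ v →
  partsMeeting (part S t) (inBall (rel S (suc t)) r v) ≤ k

ValencyAtMost : ∀ {n} {G : Graph n} → MergeSeq G → ℕ → Set
ValencyAtMost S Δ =
  ∀ t → suc t < len S → ∀ x →
  partsMeeting (part S t) (λ w → ⌊ part S (suc t) w ≟ part S (suc t) x ⌋) ≤ Δ

Word : Set
Word = List Bool

record LabellingScheme (C : GraphClass) : Set where
  field
    encoder : ∀ {n} → Graph n → Fin n → Word
    decoder : Word → Word → Bool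
    correct : ∀ {n} (G : Graph n) → C G → ∀ u v → u ≢ v →
              (adj G u v ≡ true ⇔ decoder (encoder G u) (encoder G v) ≡ true)
open LabellingScheme public

LengthBigO : ∀ {C : GraphClass} → LabellingScheme C → (ℕ → ℕ) → Set
LengthBigO {C} L f =
  ∃[ c ] ∃[ n₀ ] (∀ n → n₀ ≤ n → (G : Graph n) → C G → (u : Fin n) →
    length (encoder L G u) ≤ c * f n)

-- The label of a vertex u records, for every level t of the merge sequence, the parts of P_t
-- that meet Ball¹_{R_{t+1}}(u), each with one bit: whether u has a neighbour in that part
-- outside R_t. These parts form a trie under refinement, each keyed by its ⌈log₂ Δ⌉-bit rank
-- among the parts of P_t inside its parent, and the label of v also contains v's own key path.
-- To decide uv, follow v's path down u's trie: at the first level t where v's part is missing,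
-- uv ∉ R_{t+1}, so by homogeneity the bit stored one level up is the answer (at level 0 the
-- parts are singletons). Each level contributes at most k nodes, so labels have O(m k log Δ)
-- bits. Membership in the class is only a predicate, so the encoder finds such a labelling by
-- exhaustive search.

module Submission where

open import Defs
open import Data.Nat using (ℕ; _*_; _≤_)
open import Data.Nat.Logarithm using (⌈log₂_⌉)
open import Data.Product using (Σ; ∃; ∃-syntax; _×_; _,_)

open import Data.Bool using (Bool; true; false; _∧_; _∨_; not; if_then_else_)
open import Data.Bool.Properties using (∨-zeroʳ; ∧-conicalˡ; ∧-conicalʳ; ¬-not)
import Data.Bool.Properties as Bool
open import Data.Fin using (Fin; _≟_)
import Data.Fin as F
import Data.Fin.Properties as FP
open import Data.List using (List; []; _∷_; _++_; length; map; concatMap; cartesianProductWith)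
import Data.List.Properties as List
open import Data.List.Membership.Propositional using (_∈_; lose)
open import Data.List.Membership.Propositional.Properties using (∈-cartesianProductWith⁺)
open import Data.List.Relation.Unary.All using (All; []; _∷_)
import Data.List.Relation.Unary.All as All
open import Data.List.Relation.Unary.Any using (Any; here; there; any?; satisfied)
open import Data.Maybe using (Maybe; just; nothing; maybe′)
open import Data.Nat
  using (zero; suc; _+_; _∸_; _<_; _^_; _≤′_; ≤′-refl; ≤′-step; z≤n; s≤s; NonZero; ⌈_/2⌉)
open import Data.Nat.DivMod using (_%_; _mod_; m%n<n; m<n⇒m%n≡m)
open import Data.Nat.Induction using (<-wellFounded)
open import Data.Nat.ListAction using (sum)
open import Data.Nat.Logarithm using (⌈log₂⌉-mono-≤)
open import Data.Nat.Logarithm.Core using (⌈log2⌉)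
open import Data.Nat.Properties
  using ( ≤-refl; ≤-reflexive; ≤-trans; <-trans; <-≤-trans; <⇒≤; <-irrefl; ≤⇒≤′; ≰⇒>; _≤?_
        ; n≤1+n; n<1+n; n<1⇒n≡0; m≤m+n; m≤n+m; m∸n+n≡m; +-comm; +-suc; +-identityʳ
        ; +-mono-≤; +-monoˡ-≤; +-monoʳ-≤; *-zeroʳ; *-distribˡ-+; *-assoc; *-monoˡ-≤; *-monoʳ-≤
        ; m^n≢0; ⌊n/2⌋+⌈n/2⌉≡n; ⌊n/2⌋≤⌈n/2⌉; ⌈n/2⌉<n; +-0-commutativeMonoid
        ; module ≤-Reasoning )
open import Data.Nat.Tactic.RingSolver using (solve-∀)
open import Algebra.Properties.CommutativeMonoid.Sum +-0-commutativeMonoid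
  using (sum-syntax; sum-cong-≗; ∑-distrib-+; sum-replicate-zero)
open import Data.Empty using (⊥)
open import Data.Product using (proj₁; proj₂; uncurry; map₁; Σ-syntax)
open import Data.Unit using (⊤; tt)
open import Data.Vec using (Vec; []; _∷_)
import Data.Vec as Vec
import Data.Vec.Properties as Vec
open import Function.Base using (_∘_)
open import Function.Bundles using (Injection; mk⇔)
open import Function.Properties.Inverse using (↔⇒↣)
open import Induction.WellFounded using (Acc; acc)
open import Relation.Binary using (tri<; tri≈; tri>)
open import Relation.Binary.PropositionalEquality
open import Relation.Nullary using (¬_; Dec; yes; no; contradiction; ¬?; _→-dec_; _×-dec_)
open import Relation.Nullary.Decidable using (⌊_⌋)

⌊⌋-true : ∀ {A : Set} (d : Dec A) → A → ⌊ d ⌋ ≡ true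
⌊⌋-true (yes _) _ = refl
⌊⌋-true (no ¬a) a = contradiction a ¬a

⌊⌋-false : ∀ {A : Set} (d : Dec A) → ¬ A → ⌊ d ⌋ ≡ false
⌊⌋-false (yes a) ¬a = contradiction a ¬a
⌊⌋-false (no _) _ = refl

⌊⌋-sound : ∀ {A : Set} (d : Dec A) → ⌊ d ⌋ ≡ true → A
⌊⌋-sound (yes a) _ = a

∧-intro : ∀ {a b} → a ≡ true → b ≡ true → a ∧ b ≡ true
∧-intro refl refl = refl

anyF⁺ : ∀ {n} (f : Fin n → Bool) i → f i ≡ true → anyF f ≡ true
anyF⁺ f F.zero fi rewrite fi = refl
anyF⁺ f (F.suc i) fi with f F.zero
... | true = refl
... | false = anyF⁺ (f ∘ F.suc) i fi

anyF⁻ : ∀ {n} (f : Fin n → Bool) → anyF f ≡ true → ∃[ i ] f i ≡ true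
anyF⁻ {zero} f ()
anyF⁻ {suc n} f any-f with f F.zero in f0
... | true = F.zero , f0
... | false with anyF⁻ (f ∘ F.suc) any-f
...   | i , fi = F.suc i , fi

countF-false : ∀ n → countF {n} (λ _ → false) ≡ 0
countF-false zero = refl
countF-false (suc n) = countF-false n

countF-mono : ∀ {n} (f g : Fin n → Bool) → (∀ i → f i ≡ true → g i ≡ true) → countF f ≤ countF g
countF-mono {zero} f g f⊆g = z≤n
countF-mono {suc n} f g f⊆g with f F.zero in f0 | g F.zero in g0
... | true  | true  = s≤s (countF-mono (f ∘ F.suc) (g ∘ F.suc) (f⊆g ∘ F.suc))
... | true  | false = contradiction (trans (sym (f⊆g F.zero f0)) g0) λ ()
... | false | true  = ≤-trans (countF-mono (f ∘ F.suc) (g ∘ F.suc) (f⊆g ∘ F.suc)) (n≤1+n _)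
... | false | false = countF-mono (f ∘ F.suc) (g ∘ F.suc) (f⊆g ∘ F.suc)

countF-mono-< : ∀ {n} (f g : Fin n → Bool) → (∀ i → f i ≡ true → g i ≡ true) →
                ∀ j → g j ≡ true → f j ≡ false → countF f < countF g
countF-mono-< f g f⊆g F.zero gj fj rewrite gj | fj =
  s≤s (countF-mono (f ∘ F.suc) (g ∘ F.suc) (f⊆g ∘ F.suc))
countF-mono-< {suc n} f g f⊆g (F.suc j) gj fj with f F.zero in f0 | g F.zero in g0
... | true  | true  = s≤s (countF-mono-< (f ∘ F.suc) (g ∘ F.suc) (f⊆g ∘ F.suc) j gj fj)
... | true  | false = contradiction (trans (sym (f⊆g F.zero f0)) g0) λ ()
... | false | true  = ≤-trans (countF-mono-< (f ∘ F.suc) (g ∘ F.suc) (f⊆g ∘ F.suc) j gj fj) (n≤1+n _)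
... | false | false = countF-mono-< (f ∘ F.suc) (g ∘ F.suc) (f⊆g ∘ F.suc) j gj fj

countF>0 : ∀ {n} (f : Fin n → Bool) i → f i ≡ true → 0 < countF f
countF>0 {n} f i fi = subst (_< countF f) (countF-false n) (countF-mono-< (λ _ → false) f (λ _ ()) i fi refl)

countF≤anyF : ∀ {n} (f : Fin n → Bool) → (∀ i j → f i ≡ true → f j ≡ true → i ≡ j) →
              countF f ≤ (if anyF f then 1 else 0)
countF≤anyF {zero} f unique = z≤n
countF≤anyF {suc n} f unique with f F.zero in f0
... | true = s≤s (subst (countF (f ∘ F.suc) ≤_) (countF-false n) (countF-mono (f ∘ F.suc) (λ _ → false)
               λ i fi → contradiction (unique (F.suc i) F.zero fi f0) λ ()))
... | false = countF≤anyF (f ∘ F.suc) (λ i j fi fj → FP.suc-injective (unique _ _ fi fj))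

countF≡∑ : ∀ {n} (f : Fin n → Bool) → countF f ≡ ∑[ i < n ] (if f i then 1 else 0)
countF≡∑ {zero} f = refl
countF≡∑ {suc n} f = cong ((if f F.zero then 1 else 0) +_) (countF≡∑ (f ∘ F.suc))

∑-countF-disjoint : ∀ {n m} (W : Fin n → Fin m → Bool) →
  (∀ ℓ ℓ′ x → W ℓ x ≡ true → W ℓ′ x ≡ true → ℓ ≡ ℓ′) →
  ∑[ ℓ < n ] countF (W ℓ) ≤ countF (λ x → anyF (λ ℓ → W ℓ x))
∑-countF-disjoint {n} {zero} W disjoint = ≤-reflexive (sum-replicate-zero n)
∑-countF-disjoint {n} {suc m} W disjoint = begin
  ∑[ ℓ < n ] (ind (W ℓ F.zero) + countF (λ x → W ℓ (F.suc x)))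
    ≡⟨ ∑-distrib-+ (λ ℓ → ind (W ℓ F.zero)) (λ ℓ → countF (λ x → W ℓ (F.suc x))) ⟩
  ∑[ ℓ < n ] ind (W ℓ F.zero) + ∑[ ℓ < n ] countF (λ x → W ℓ (F.suc x))
    ≡⟨ cong (_+ ∑[ ℓ < n ] countF (λ x → W ℓ (F.suc x))) (countF≡∑ (λ ℓ → W ℓ F.zero)) ⟨
  countF (λ ℓ → W ℓ F.zero) + ∑[ ℓ < n ] countF (λ x → W ℓ (F.suc x))
    ≤⟨ +-mono-≤ (countF≤anyF (λ ℓ → W ℓ F.zero) (λ ℓ ℓ′ → disjoint ℓ ℓ′ F.zero))
                (∑-countF-disjoint (λ ℓ x → W ℓ (F.suc x)) (λ ℓ ℓ′ x → disjoint ℓ ℓ′ (F.suc x))) ⟩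
  ind (anyF (λ ℓ → W ℓ F.zero)) + countF (λ x → anyF (λ ℓ → W ℓ (F.suc x))) ∎
  where
  open ≤-Reasoning
  ind : Bool → ℕ
  ind b = if b then 1 else 0

∑-mono-≤ : ∀ {n} {f g : Fin n → ℕ} → (∀ i → f i ≤ g i) → ∑[ i < n ] f i ≤ ∑[ i < n ] g i
∑-mono-≤ {zero} f≤g = z≤n
∑-mono-≤ {suc n} f≤g = +-mono-≤ (f≤g F.zero) (∑-mono-≤ (f≤g ∘ F.suc))

if-mono-≤ : ∀ b {x y} → x ≤ y → (if b then x else 0) ≤ (if b then y else 0)
if-mono-≤ true x≤y = x≤y
if-mono-≤ false _ = z≤n

if-countF : ∀ b {n} (f : Fin n → Bool) → (if b then countF f else 0) ≡ countF (λ i → b ∧ f i)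
if-countF true f = refl
if-countF false {n} f = sym (countF-false n)

sumBelow : ℕ → (ℕ → ℕ) → ℕ
sumBelow zero f = 0
sumBelow (suc t) f = f t + sumBelow t f

sumBelow-mono-≤ : ∀ t {f g : ℕ → ℕ} → (∀ s → s < t → f s ≤ g s) → sumBelow t f ≤ sumBelow t g
sumBelow-mono-≤ zero f≤g = z≤n
sumBelow-mono-≤ (suc t) f≤g =
  +-mono-≤ (f≤g t ≤-refl) (sumBelow-mono-≤ t (λ s s<t → f≤g s (≤-trans s<t (n≤1+n t))))

sumBelow-const : ∀ t k → sumBelow t (λ _ → k) ≡ t * k
sumBelow-const zero k = refl
sumBelow-const (suc t) k = cong (k +_) (sumBelow-const t k)

if-suc-sumBelow : ∀ b {t} (f : ℕ → ℕ) →
  (if b then suc (sumBelow t f) else 0) ≡ (if b then 1 else 0) + sumBelow t (λ s → if b then f s else 0)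
if-suc-sumBelow true f = refl
if-suc-sumBelow false {t} f = sym (trans (sumBelow-const t 0) (*-zeroʳ t))

∑-sumBelow-comm : ∀ {n} t (g : ℕ → Fin n → ℕ) →
  ∑[ i < n ] sumBelow t (λ s → g s i) ≡ sumBelow t (λ s → ∑[ i < n ] g s i)
∑-sumBelow-comm {n} zero g = sum-replicate-zero n
∑-sumBelow-comm {n} (suc t) g =
  trans (∑-distrib-+ (g t) (λ i → sumBelow t (λ s → g s i)))
        (cong (∑[ i < n ] g t i +_) (∑-sumBelow-comm t g))

rank : ∀ {n} → (Fin n → Bool) → Fin n → ℕ
rank P a = countF (λ ℓ → ⌊ ℓ FP.<? a ⌋ ∧ P ℓ)

module _ {n} (P : Fin n → Bool) where

  private
    not-below-self : ∀ a → (⌊ a FP.<? a ⌋ ∧ P a) ≡ false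
    not-below-self a = cong (_∧ P a) (⌊⌋-false (a FP.<? a) (FP.<-irrefl refl))

  rank<countF : ∀ {a} → P a ≡ true → rank P a < countF P
  rank<countF {a} Pa = countF-mono-< _ P (λ ℓ → ∧-conicalʳ _ _) a Pa (not-below-self a)

  rank-mono-< : ∀ {a b} → P a ≡ true → a F.< b → rank P a < rank P b
  rank-mono-< {a} {b} Pa a<b = countF-mono-< _ _ below-a⇒below-b a
    (∧-intro (⌊⌋-true (a FP.<? b) a<b) Pa) (not-below-self a)
    where
    below-a⇒below-b : ∀ ℓ → (⌊ ℓ FP.<? a ⌋ ∧ P ℓ) ≡ true → (⌊ ℓ FP.<? b ⌋ ∧ P ℓ) ≡ true
    below-a⇒below-b ℓ e = ∧-intro
      (⌊⌋-true (ℓ FP.<? b) (FP.<-trans (⌊⌋-sound (ℓ FP.<? a) (∧-conicalˡ _ _ e)) a<b))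
      (∧-conicalʳ _ _ e)

  rank-injective : ∀ {a b} → P a ≡ true → P b ≡ true → rank P a ≡ rank P b → a ≡ b
  rank-injective {a} {b} Pa Pb eq with FP.<-cmp a b
  ... | tri< a<b _ _ = contradiction (rank-mono-< Pa a<b) (<-irrefl eq)
  ... | tri≈ _ a≡b _ = a≡b
  ... | tri> _ _ b<a = contradiction (rank-mono-< Pb b<a) (<-irrefl (sym eq))

-- Binary codes and self-delimiting codecs

code : ∀ w → Fin (2 ^ w) → Word
code zero _ = []
code (suc w) i = Bit.to (proj₁ (F.remQuot {2} (2 ^ w) i)) ∷ code w (proj₂ (F.remQuot {2} (2 ^ w) i))
  where module Bit = Injection (↔⇒↣ FP.2↔Bool)

code-injective : ∀ w {i j} → code w i ≡ code w j → i ≡ j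
code-injective zero {F.zero} {F.zero} _ = refl
code-injective (suc w) {i} {j} eq = begin
  i                                             ≡⟨ FP.combine-remQuot {2} (2 ^ w) i ⟨
  uncurry F.combine (F.remQuot {2} (2 ^ w) i)  ≡⟨ cong (uncurry F.combine) (cong₂ _,_ heads tails) ⟩
  uncurry F.combine (F.remQuot {2} (2 ^ w) j)  ≡⟨ FP.combine-remQuot {2} (2 ^ w) j ⟩
  j                                             ∎
  where
  open ≡-Reasoning
  heads : proj₁ (F.remQuot {2} (2 ^ w) i) ≡ proj₁ (F.remQuot {2} (2 ^ w) j)
  heads = Injection.injective (↔⇒↣ FP.2↔Bool) (List.∷-injectiveˡ eq)
  tails : proj₂ (F.remQuot {2} (2 ^ w) i) ≡ proj₂ (F.remQuot {2} (2 ^ w) j)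
  tails = code-injective w (List.∷-injectiveʳ eq)

length-code : ∀ w i → length (code w i) ≡ w
length-code zero _ = refl
length-code (suc w) i = cong suc (length-code w _)

module _ (w : ℕ) where

  private instance
    2^w-nonZero : NonZero (2 ^ w)
    2^w-nonZero = m^n≢0 2 w

  binary : ℕ → Word
  binary i = code w (i mod 2 ^ w)

  length-binary : ∀ i → length (binary i) ≡ w
  length-binary i = length-code w _

  binary-injective : ∀ {i j} → i < 2 ^ w → j < 2 ^ w → binary i ≡ binary j → i ≡ j
  binary-injective {i} {j} i< j< eq = begin
    i                    ≡⟨ m<n⇒m%n≡m i< ⟨
    i % 2 ^ w            ≡⟨ FP.toℕ-fromℕ< (m%n<n i (2 ^ w)) ⟨
    F.toℕ (i mod 2 ^ w)  ≡⟨ cong F.toℕ (code-injective w eq) ⟩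
    F.toℕ (j mod 2 ^ w)  ≡⟨ FP.toℕ-fromℕ< (m%n<n j (2 ^ w)) ⟩
    j % 2 ^ w            ≡⟨ m<n⇒m%n≡m j< ⟩
    j                    ∎
    where open ≡-Reasoning

n≤2^⌈log₂n⌉ : ∀ n → n ≤ 2 ^ ⌈log₂ n ⌉
n≤2^⌈log₂n⌉ n = go n (<-wellFounded n)
  where
  go : ∀ n (rec : Acc _<_ n) → n ≤ 2 ^ ⌈log2⌉ n rec
  go 0 _ = z≤n
  go 1 _ = s≤s z≤n
  go (suc (suc n)) (acc rs) = begin
    2 + n                      ≤⟨ s≤s (s≤s n≤⌈n/2⌉+⌈n/2⌉) ⟩
    2 + (⌈ n /2⌉ + ⌈ n /2⌉)    ≡⟨ cong suc (+-suc ⌈ n /2⌉ ⌈ n /2⌉) ⟨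
    suc ⌈ n /2⌉ + suc ⌈ n /2⌉  ≤⟨ +-mono-≤ half (≤-trans half (≤-reflexive (sym (+-identityʳ _)))) ⟩
    2 ^ suc (⌈log2⌉ (suc ⌈ n /2⌉) (rs (⌈n/2⌉<n n))) ∎
    where
    open ≤-Reasoning
    half : suc ⌈ n /2⌉ ≤ 2 ^ ⌈log2⌉ (suc ⌈ n /2⌉) (rs (⌈n/2⌉<n n))
    half = go (suc ⌈ n /2⌉) (rs (⌈n/2⌉<n n))
    n≤⌈n/2⌉+⌈n/2⌉ : n ≤ ⌈ n /2⌉ + ⌈ n /2⌉
    n≤⌈n/2⌉+⌈n/2⌉ =
      subst (_≤ ⌈ n /2⌉ + ⌈ n /2⌉) (⌊n/2⌋+⌈n/2⌉≡n n) (+-monoˡ-≤ ⌈ n /2⌉ (⌊n/2⌋≤⌈n/2⌉ n))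

record Codec (A : Set) : Set where
  field
    encode        : A → List Bool
    decode        : List Bool → A × List Bool
    decode-encode : ∀ a s → decode (encode a ++ s) ≡ (a , s)
open Codec public

decode-encode-[] : ∀ {A} (c : Codec A) a → decode c (encode c a) ≡ (a , [])
decode-encode-[] c a = trans (cong (decode c) (sym (List.++-identityʳ (encode c a)))) (decode-encode c a [])

bool : Codec Bool
bool = record { encode = _∷ [] ; decode = decode′ ; decode-encode = λ _ _ → refl }
  where
  decode′ : List Bool → Bool × List Bool
  decode′ [] = false , []
  decode′ (b ∷ s) = b , s

unary : Codec ℕ
unary = record { encode = encode′ ; decode = decode′ ; decode-encode = decode′-encode′ }
  where
  encode′ : ℕ → List Bool
  encode′ zero = false ∷ []
  encode′ (suc k) = true ∷ encode′ k
  decode′ : List Bool → ℕ × List Bool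
  decode′ [] = 0 , []
  decode′ (false ∷ s) = 0 , s
  decode′ (true ∷ s) = map₁ suc (decode′ s)
  decode′-encode′ : ∀ k s → decode′ (encode′ k ++ s) ≡ (k , s)
  decode′-encode′ zero s = refl
  decode′-encode′ (suc k) s = cong (map₁ suc) (decode′-encode′ k s)

length-encode-unary : ∀ k → length (encode unary k) ≡ suc k
length-encode-unary zero = refl
length-encode-unary (suc k) = cong suc (length-encode-unary k)

Σ-codec : ∀ {A : Set} {B : A → Set} → Codec A → ((a : A) → Codec (B a)) → Codec (Σ A B)
Σ-codec {A} {B} c d = record { encode = encode′ ; decode = decode′ ; decode-encode = decode′-encode′ }
  where
  encode′ : Σ A B → List Bool
  encode′ (a , b) = encode c a ++ encode (d a) b
  decode′ : List Bool → Σ A B × List Bool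
  decode′ s = let (a , s₁) = decode c s ; (b , s₂) = decode (d a) s₁ in (a , b) , s₂
  decode′-encode′ : ∀ ab s → decode′ (encode′ ab ++ s) ≡ (ab , s)
  decode′-encode′ (a , b) s
    rewrite List.++-assoc (encode c a) (encode (d a) b) s
          | decode-encode c a (encode (d a) b ++ s)
          | decode-encode (d a) b s = refl

_⊗_ : ∀ {A B : Set} → Codec A → Codec B → Codec (A × B)
c ⊗ d = Σ-codec c (λ _ → d)

iso : ∀ {A B : Set} (f : A → B) (g : B → A) → (∀ b → f (g b) ≡ b) → Codec A → Codec B
iso f g fg c = record
  { encode = encode c ∘ g
  ; decode = map₁ f ∘ decode c
  ; decode-encode = λ b s → trans (cong (map₁ f) (decode-encode c (g b) s)) (cong (_, s) (fg b))
  }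

list : ∀ {A} → Codec A → Codec (List A)
list {A} c = record { encode = encode′ ; decode = decode′ ; decode-encode = decode′-encode′ }
  where
  encode′ : List A → List Bool
  encode′ xs = encode unary (length xs) ++ concatMap (encode c) xs
  decodeMany : ℕ → List Bool → List A × List Bool
  decodeMany zero s = [] , s
  decodeMany (suc k) s = let (a , s₁) = decode c s ; (as , s₂) = decodeMany k s₁ in a ∷ as , s₂
  decode′ : List Bool → List A × List Bool
  decode′ s = let (k , s₁) = decode unary s in decodeMany k s₁
  decodeMany-concatMap : ∀ xs s → decodeMany (length xs) (concatMap (encode c) xs ++ s) ≡ (xs , s)
  decodeMany-concatMap [] s = refl
  decodeMany-concatMap (x ∷ xs) s
    rewrite List.++-assoc (encode c x) (concatMap (encode c) xs) s
          | decode-encode c x (concatMap (encode c) xs ++ s)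
          | decodeMany-concatMap xs s = refl
  decode′-encode′ : ∀ xs s → decode′ (encode′ xs ++ s) ≡ (xs , s)
  decode′-encode′ xs s
    rewrite List.++-assoc (encode unary (length xs)) (concatMap (encode c) xs) s
          | decode-encode unary (length xs) (concatMap (encode c) xs ++ s) = decodeMany-concatMap xs s

length-encode-list≤ : ∀ {A} (c : Codec A) (f : A → ℕ) {xs} → All (λ x → length (encode c x) ≤ f x) xs →
                      length (encode (list c) xs) ≤ suc (sum (map (suc ∘ f) xs))
length-encode-list≤ c f {xs} bounded = begin
  length (encode unary (length xs) ++ concatMap (encode c) xs)
    ≡⟨ List.length-++ (encode unary (length xs)) ⟩
  length (encode unary (length xs)) + length (concatMap (encode c) xs)
    ≡⟨ cong (_+ length (concatMap (encode c) xs)) (length-encode-unary (length xs)) ⟩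
  suc (length xs + length (concatMap (encode c) xs))
    ≤⟨ s≤s (items bounded) ⟩
  suc (sum (map (suc ∘ f) xs)) ∎
  where
  open ≤-Reasoning
  +-comm-middle : ∀ a b c → a + (b + c) ≡ b + (a + c)
  +-comm-middle = solve-∀
  items : ∀ {xs} → All (λ x → length (encode c x) ≤ f x) xs →
          length xs + length (concatMap (encode c) xs) ≤ sum (map (suc ∘ f) xs)
  items [] = z≤n
  items {x ∷ xs} (px ∷ pxs) = begin
    suc (length xs + length (encode c x ++ concatMap (encode c) xs))
      ≡⟨ cong (λ l → suc (length xs + l)) (List.length-++ (encode c x)) ⟩
    suc (length xs + (length (encode c x) + length (concatMap (encode c) xs)))
      ≡⟨ cong suc (+-comm-middle (length xs) (length (encode c x)) _) ⟩
    suc (length (encode c x) + (length xs + length (concatMap (encode c) xs)))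
      ≤⟨ s≤s (+-mono-≤ px (items pxs)) ⟩
    suc (f x + sum (map (suc ∘ f) xs)) ∎

sum-map-const : ∀ {A : Set} k (xs : List A) → sum (map (λ _ → k) xs) ≡ length xs * k
sum-map-const k [] = refl
sum-map-const k (x ∷ xs) = cong (k +_) (sum-map-const k xs)

sum-map-* : ∀ {A : Set} k (f : A → ℕ) xs → sum (map (λ x → k * f x) xs) ≡ k * sum (map f xs)
sum-map-* k f [] = sym (*-zeroʳ k)
sum-map-* k f (x ∷ xs) = trans (cong (k * f x +_) (sum-map-* k f xs)) (sym (*-distribˡ-+ k (f x) _))

word : Codec Word
word = list bool

length-encode-word≤ : ∀ {w} c → length c ≤ w → length (encode word c) ≤ suc (w * 2)
length-encode-word≤ {w} c c≤w = begin
  length (encode word c)       ≤⟨ length-encode-list≤ bool (λ _ → 1) (All.universal (λ _ → ≤-refl) c) ⟩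
  suc (sum (map (λ _ → 2) c))  ≡⟨ cong suc (sum-map-const 2 c) ⟩
  suc (length c * 2)           ≤⟨ s≤s (*-monoˡ-≤ 2 c≤w) ⟩
  suc (w * 2)                  ∎
  where open ≤-Reasoning

-- Tries

data Trie : ℕ → Set where
  leaf : Bool → Trie zero
  node : ∀ {t} → Bool → List (Word × Trie t) → Trie (suc t)

_≟ʷ_ : (c c′ : Word) → Dec (c ≡ c′)
_≟ʷ_ = List.≡-dec Bool._≟_

lookupKey : ∀ {A : Set} → Word → List (Word × A) → Maybe A
lookupKey k [] = nothing
lookupKey k ((c , a) ∷ cs) with k ≟ʷ c
... | yes _ = just a
... | no _ = lookupKey k cs

query : ∀ {t} → Trie t → List Word → Bool
query (leaf b) _ = b
query (node b cs) [] = b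
query (node b cs) (k ∷ p) = maybe′ (λ τ → query τ p) b (lookupKey k cs)

size : ∀ {t} → Trie t → ℕ
size (leaf _) = 0
size (node _ cs) = sum (map (λ (_ , τ) → suc (size τ)) cs)

KeysAtMost : ℕ → ∀ {t} → Trie t → Set
KeysAtMost w (leaf _) = ⊤
KeysAtMost w (node _ cs) = All (λ (c , τ) → length c ≤ w × KeysAtMost w τ) cs

trie : ∀ t → Codec (Trie t)
trie zero = iso leaf (λ { (leaf b) → b }) (λ { (leaf b) → refl }) bool
trie (suc t) = iso (uncurry node) (λ { (node b cs) → b , cs }) (λ { (node b cs) → refl })
                   (bool ⊗ list (word ⊗ trie t))

length-encode-trie : ∀ w {t} (τ : Trie t) → KeysAtMost w τ →
                     length (encode (trie t) τ) ≤ 2 + (2 * w + 4) * size τ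
length-encode-trie w (leaf b) _ = s≤s z≤n
length-encode-trie w {suc t} (node b cs) keys = s≤s (begin
  length (encode (list (word ⊗ trie t)) cs)
    ≤⟨ length-encode-list≤ (word ⊗ trie t) bound (All.map (λ {p} → child-bound p) keys) ⟩
  suc (sum (map (suc ∘ bound) cs))
    ≡⟨ cong (suc ∘ sum) (List.map-cong suc-bound cs) ⟩
  suc (sum (map (λ (_ , τ) → K * suc (size τ)) cs))
    ≡⟨ cong suc (sum-map-* K (λ (_ , τ) → suc (size τ)) cs) ⟩
  suc (K * size (node b cs)) ∎)
  where
  open ≤-Reasoning
  K : ℕ
  K = 2 * w + 4
  bound : Word × Trie t → ℕ
  bound (_ , τ) = suc (w * 2) + (2 + K * size τ)
  suc-bound : ∀ p → suc (bound p) ≡ K * suc (size (proj₂ p))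
  suc-bound (_ , τ) = expand w (size τ)
    where
    expand : ∀ w s → suc (suc (w * 2) + (2 + (2 * w + 4) * s)) ≡ (2 * w + 4) * suc s
    expand = solve-∀
  child-bound : ∀ p → length (proj₁ p) ≤ w × KeysAtMost w (proj₂ p) →
                length (encode (word ⊗ trie t) p) ≤ bound p
  child-bound (c , τ) (c≤w , keys) = begin
    length (encode word c ++ encode (trie t) τ)          ≡⟨ List.length-++ (encode word c) ⟩
    length (encode word c) + length (encode (trie t) τ)  ≤⟨ +-mono-≤ (length-encode-word≤ c c≤w)
                                                                     (length-encode-trie w τ keys) ⟩
    bound (c , τ)                                         ∎

tabulateWhen : ∀ {n} {A : Set} → (Fin n → Bool) → (Fin n → A) → List A
tabulateWhen {zero} Q h = []
tabulateWhen {suc n} Q h =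
  if Q F.zero then h F.zero ∷ tabulateWhen (Q ∘ F.suc) (h ∘ F.suc) else tabulateWhen (Q ∘ F.suc) (h ∘ F.suc)

module _ {A : Set} where

  sum-map-tabulateWhen : ∀ {n} (Q : Fin n → Bool) (h : Fin n → A) (g : A → ℕ) →
    sum (map g (tabulateWhen Q h)) ≡ ∑[ i < n ] (if Q i then g (h i) else 0)
  sum-map-tabulateWhen {zero} Q h g = refl
  sum-map-tabulateWhen {suc n} Q h g with Q F.zero
  ... | true = cong (g (h F.zero) +_) (sum-map-tabulateWhen (Q ∘ F.suc) (h ∘ F.suc) g)
  ... | false = sum-map-tabulateWhen (Q ∘ F.suc) (h ∘ F.suc) g

  All-tabulateWhen : ∀ {n} {P : A → Set} (Q : Fin n → Bool) (h : Fin n → A) →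
    (∀ i → Q i ≡ true → P (h i)) → All P (tabulateWhen Q h)
  All-tabulateWhen {zero} Q h Ph = []
  All-tabulateWhen {suc n} Q h Ph with Q F.zero in q
  ... | true = Ph F.zero q ∷ All-tabulateWhen (Q ∘ F.suc) (h ∘ F.suc) (Ph ∘ F.suc)
  ... | false = All-tabulateWhen (Q ∘ F.suc) (h ∘ F.suc) (Ph ∘ F.suc)

  lookupKey-tabulateWhen-∉ : ∀ {n} (Q : Fin n → Bool) (key : Fin n → Word) (f : Fin n → A) {k} →
    (∀ i → Q i ≡ true → key i ≢ k) → lookupKey k (tabulateWhen Q (λ i → key i , f i)) ≡ nothing
  lookupKey-tabulateWhen-∉ {zero} Q key f absent = refl
  lookupKey-tabulateWhen-∉ {suc n} Q key f {k} absent with Q F.zero in q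
  ... | false = lookupKey-tabulateWhen-∉ (Q ∘ F.suc) (key ∘ F.suc) (f ∘ F.suc) (absent ∘ F.suc)
  ... | true with k ≟ʷ key F.zero
  ...   | yes k≡key₀ = contradiction (sym k≡key₀) (absent F.zero q)
  ...   | no _ = lookupKey-tabulateWhen-∉ (Q ∘ F.suc) (key ∘ F.suc) (f ∘ F.suc) (absent ∘ F.suc)

  lookupKey-tabulateWhen-∈ : ∀ {n} (Q : Fin n → Bool) (key : Fin n → Word) (f : Fin n → A) {x} →
    Q x ≡ true → (∀ i → Q i ≡ true → key i ≡ key x → i ≡ x) →
    lookupKey (key x) (tabulateWhen Q (λ i → key i , f i)) ≡ just (f x)
  lookupKey-tabulateWhen-∈ {suc n} Q key f {x} Qx unique with Q F.zero in q
  lookupKey-tabulateWhen-∈ Q key f {F.zero} Qx unique | false = contradiction (trans (sym Qx) q) λ ()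
  lookupKey-tabulateWhen-∈ Q key f {F.suc x} Qx unique | false =
    lookupKey-tabulateWhen-∈ (Q ∘ F.suc) (key ∘ F.suc) (f ∘ F.suc) Qx
      (λ i Qi eq → FP.suc-injective (unique (F.suc i) Qi eq))
  lookupKey-tabulateWhen-∈ Q key f {x} Qx unique | true with key x ≟ʷ key F.zero
  ... | yes eq = cong (just ∘ f) (unique F.zero q (sym eq))
  lookupKey-tabulateWhen-∈ Q key f {F.zero} Qx unique | true | no neq = contradiction refl neq
  lookupKey-tabulateWhen-∈ Q key f {F.suc x} Qx unique | true | no _ =
    lookupKey-tabulateWhen-∈ (Q ∘ F.suc) (key ∘ F.suc) (f ∘ F.suc) Qx
      (λ i Qi eq → FP.suc-injective (unique (F.suc i) Qi eq))

Label : Set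
Label = List Word × Σ ℕ Trie

label : Codec Label
label = list word ⊗ Σ-codec unary trie

decideAdjacency : Word → Word → Bool
decideAdjacency ℓᵤ ℓᵥ =
  query (proj₂ (proj₂ (proj₁ (decode label ℓᵤ)))) (proj₁ (proj₁ (decode label ℓᵥ)))

decideAdjacency-encode : ∀ P t (τ : Trie t) P′ x →
  decideAdjacency (encode label (P , t , τ)) (encode label (P′ , x)) ≡ query τ P′
decideAdjacency-encode P t τ P′ x =
  cong₂ (λ dᵤ dᵥ → query (proj₂ (proj₂ (proj₁ dᵤ))) (proj₁ (proj₁ dᵥ)))
        (decode-encode-[] label (P , t , τ)) (decode-encode-[] label (P′ , x))

Represents : ∀ {n} → Graph n → (Fin n → Word) → Set
Represents G f = ∀ u v → u ≢ v → adj G u v ≡ decideAdjacency (f u) (f v)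

ShortRepresentation : ∀ {n} → ℕ → Graph n → Set
ShortRepresentation {n} b G = Σ[ f ∈ (Fin n → Word) ] (∀ u → length (f u) ≤ b) × Represents G f

trivial-representation : ∀ {n} (G : Graph n) → (∀ x y → x ≡ y) → Represents G (λ _ → [])
trivial-representation G all-equal u v u≢v = contradiction (all-equal u v) u≢v

∅ : ∀ {n} → PairSet n
∅ _ _ = false

adjModulo : ∀ {n} → Graph n → Partition n → PairSet n → Fin n → Fin n → Bool
adjModulo G p R u ℓ = anyF (λ x → ⌊ p x ≟ ℓ ⌋ ∧ not (R u x) ∧ adj G u x)

adj⇒≢ : ∀ {n} (G : Graph n) {x y} → adj G x y ≡ true → x ≢ y
adj⇒≢ G {x} xy refl = contradiction (trans (sym xy) (irrefl G x)) λ ()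

adjModulo-correct : ∀ {n} (G : Graph n) {p R} → Homogeneous G p R →
  ∀ {u v} → u ≢ v → R u v ≡ false → adjModulo G p R u (p v) ≡ adj G u v
adjModulo-correct {n} G {p} {R} hom {u} {v} u≢v uv∉R with adj G u v in uv
... | true = anyF⁺ _ v (∧-intro (⌊⌋-true (p v ≟ p v) refl) (∧-intro (cong not uv∉R) uv))
... | false = ¬-not λ witnessed → no-witness _ (proj₂ (anyF⁻ edge witnessed))
  where
  edge : Fin n → Bool
  edge x = ⌊ p x ≟ p v ⌋ ∧ not (R u x) ∧ adj G u x
  no-witness : ∀ x → edge x ≡ true → ⊥
  no-witness x e with p x ≟ p v | R u x in ux∉R | adj G u x in ux
  no-witness x () | no _  | _     | _
  no-witness x () | yes _ | true  | _
  no-witness x () | yes _ | false | false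
  no-witness x _  | yes px≡pv | false | true =
    contradiction (trans (sym ux) (trans (hom u x u v refl px≡pv (adj⇒≢ G ux) u≢v ux∉R uv∉R) uv)) λ ()

singletons-homogeneous : ∀ {n} (G : Graph n) {p : Partition n} →
                         (∀ x y → p x ≡ p y → x ≡ y) → Homogeneous G p ∅
singletons-homogeneous G singletons x y x′ y′ px py _ _ _ _ =
  cong₂ (adj G) (singletons x x′ px) (singletons y y′ py)

inBall-centre : ∀ {n} (R : PairSet n) r v → inBall R r v v ≡ true
inBall-centre R zero v = ⌊⌋-true (v ≟ v) refl
inBall-centre R (suc r) v = cong (_∨ anyF (λ u → inBall R r v u ∧ R u v)) (inBall-centre R r v)

inBall-neighbour : ∀ {n} (R : PairSet n) {u v} → R u v ≡ true → inBall R 1 u v ≡ true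
inBall-neighbour R {u} {v} uv =
  trans (cong (⌊ u ≟ v ⌋ ∨_) (anyF⁺ _ u (∧-intro (⌊⌋-true (u ≟ u) refl) uv))) (∨-zeroʳ _)

-- The hierarchy of parts of a merge sequence

module Hierarchy {n} {G : Graph n} (S : MergeSeq G) where

  part-refines : ∀ {s t} → s ≤ t → t < len S →
                 ∀ {x y} → part S s x ≡ part S s y → part S t x ≡ part S t y
  part-refines s≤t = go (≤⇒≤′ s≤t)
    where
    go : ∀ {s t} → s ≤′ t → t < len S → ∀ {x y} → part S s x ≡ part S s y → part S t x ≡ part S t y
    go ≤′-refl _ eq = eq
    go (≤′-step s≤′t) t<len eq = refines S _ t<len _ _ (go s≤′t (<-trans (n<1+n _) t<len) eq)

  within : ℕ → ℕ → Fin n → Fin n → Bool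
  within s t c ℓ = anyF (λ x → ⌊ part S t x ≟ c ⌋ ∧ ⌊ part S s x ≟ ℓ ⌋)

  within⁺ : ∀ {s t c ℓ} x → part S t x ≡ c → part S s x ≡ ℓ → within s t c ℓ ≡ true
  within⁺ {s} {t} {c} {ℓ} x tx sx =
    anyF⁺ _ x (∧-intro (⌊⌋-true (part S t x ≟ c) tx) (⌊⌋-true (part S s x ≟ ℓ) sx))

  within⁻ : ∀ {s t c ℓ} → within s t c ℓ ≡ true → ∃[ x ] part S t x ≡ c × part S s x ≡ ℓ
  within⁻ {s} {t} {c} {ℓ} w with anyF⁻ (λ x → ⌊ part S t x ≟ c ⌋ ∧ ⌊ part S s x ≟ ℓ ⌋) w
  ... | x , e = x , ⌊⌋-sound (part S t x ≟ c) (∧-conicalˡ _ _ e)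
                  , ⌊⌋-sound (part S s x ≟ ℓ) (∧-conicalʳ _ _ e)

  within-unique : ∀ {s t c c′ ℓ} → s ≤ t → t < len S →
                  within s t c ℓ ≡ true → within s t c′ ℓ ≡ true → c ≡ c′
  within-unique s≤t t<len w w′ with within⁻ w | within⁻ w′
  ... | x , tx , sx | y , ty , sy = trans (sym tx) (trans (part-refines s≤t t<len (trans sx (sym sy))) ty)

  within-trans : ∀ {s t r ℓ c d} → s ≤ t → t ≤ r → r < len S →
                 within s t c ℓ ≡ true → within t r d c ≡ true → within s r d ℓ ≡ true
  within-trans s≤t t≤r r<len w w′ with within⁻ w | within⁻ w′
  ... | x , tx , sx | y , ry , ty = within⁺ x (trans (part-refines t≤r r<len (trans tx (sym ty))) ry) sx

  siblings : ℕ → Fin n → Fin n → Bool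
  siblings t = within t (suc t)

  siblings-count : ∀ {Δ} → ValencyAtMost S Δ → ∀ {t c ℓ} → suc t < len S →
                   siblings t c ℓ ≡ true → countF (siblings t c) ≤ Δ
  siblings-count valency st<len sib with within⁻ sib
  ... | x , refl , _ = valency _ st<len x

  siblings-unique : ∀ {Δ} → ValencyAtMost S Δ → Δ ≤ 1 → ∀ {t c ℓ ℓ′} → suc t < len S →
                    siblings t c ℓ ≡ true → siblings t c ℓ′ ≡ true → ℓ ≡ ℓ′
  siblings-unique valency Δ≤1 {t} {c} st<len sib sib′ =
    rank-injective (siblings t c) sib sib′ (trans (rank≡0 sib) (sym (rank≡0 sib′)))
    where
    rank≡0 : ∀ {a} → siblings t c a ≡ true → rank (siblings t c) a ≡ 0
    rank≡0 sib = n<1⇒n≡0 (<-≤-trans (rank<countF (siblings t c) sib)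
                                    (≤-trans (siblings-count valency st<len sib) Δ≤1))

  collapse : ∀ {Δ} → ValencyAtMost S Δ → Δ ≤ 1 → ∀ x y → x ≡ y
  collapse valency Δ≤1 x y = first-singletons S x y (down (len S ∸ 1) 0 (m∸n+n≡m (len≥1 S)))
    where
    down : ∀ j t → j + suc t ≡ len S → part S t x ≡ part S t y
    down zero t eq = subst (λ s → part S s x ≡ part S s y) (cong (_∸ 1) (sym eq)) (last-whole S x y)
    down (suc j) t eq = siblings-unique valency Δ≤1 st<len (within⁺ x refl refl) (within⁺ y (sym above) refl)
      where
      above : part S (suc t) x ≡ part S (suc t) y
      above = down j (suc t) (trans (+-suc j (suc t)) eq)
      st<len : suc t < len S
      st<len = subst (suc t <_) eq (s≤s (m≤n+m (suc t) j))

  2≤len : ∀ {x y} → x ≢ y → 2 ≤ len S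
  2≤len {x} {y} x≢y with len S | len≥1 S | last-whole S x y
  ... | suc zero    | _ | whole = contradiction (first-singletons S x y whole) x≢y
  ... | suc (suc _) | _ | _     = s≤s (s≤s z≤n)

  module Coding {Δ} (valency : ValencyAtMost S Δ) where

    w : ℕ
    w = ⌈log₂ Δ ⌉

    key : ℕ → Fin n → Fin n → Word
    key t c ℓ = binary w (rank (siblings t c) ℓ)

    key-injective : ∀ {t c ℓ ℓ′} → suc t < len S →
                    siblings t c ℓ ≡ true → siblings t c ℓ′ ≡ true →
                    key t c ℓ ≡ key t c ℓ′ → ℓ ≡ ℓ′
    key-injective {t} {c} st<len sib sib′ eq =
      rank-injective (siblings t c) sib sib′ (binary-injective w (rank<2^w sib) (rank<2^w sib′) eq)
      where
      rank<2^w : ∀ {a} → siblings t c a ≡ true → rank (siblings t c) a < 2 ^ w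
      rank<2^w sib = <-≤-trans (rank<countF (siblings t c) sib)
                               (≤-trans (siblings-count valency st<len sib) (n≤2^⌈log₂n⌉ Δ))

    path : ℕ → Fin n → List Word
    path zero x = []
    path (suc t) x = key t (part S (suc t) x) (part S t x) ∷ path t x

    length-path : ∀ t x → length (path t x) ≡ t
    length-path zero x = refl
    length-path (suc t) x = cong suc (length-path t x)

    path-keys : ∀ t x → All (λ c → length c ≤ w) (path t x)
    path-keys zero x = []
    path-keys (suc t) x = ≤-reflexive (length-binary w _) ∷ path-keys t x

    module Neighbourhood (u : Fin n) where

      meetsBall : ℕ → Fin n → Bool
      meetsBall t ℓ = anyF (λ x → inBall (rel S (suc t)) 1 u x ∧ ⌊ part S t x ≟ ℓ ⌋)

      child : ℕ → Fin n → Fin n → Bool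
      child t c ℓ = meetsBall t ℓ ∧ siblings t c ℓ

      localTrie : ∀ t → Fin n → Trie t
      localTrie zero ℓ = leaf (adjModulo G (part S 0) ∅ u ℓ)
      localTrie (suc t) c = node (adjModulo G (part S (suc t)) (rel S (suc t)) u c)
                                 (tabulateWhen (child t c) (λ ℓ → key t c ℓ , localTrie t ℓ))

      module _ {t} (v : Fin n) (st<len : suc t < len S) where

        private
          c x : Fin n
          c = part S (suc t) v
          x = part S t v

        key-unique : ∀ ℓ → child t c ℓ ≡ true → key t c ℓ ≡ key t c x → ℓ ≡ x
        key-unique ℓ cℓ = key-injective st<len (∧-conicalʳ (meetsBall t ℓ) _ cℓ) (within⁺ v refl refl)

        lookup-child-∈ : meetsBall t x ≡ true →
          lookupKey (key t c x) (tabulateWhen (child t c) (λ ℓ → key t c ℓ , localTrie t ℓ))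
            ≡ just (localTrie t x)
        lookup-child-∈ meets =
          lookupKey-tabulateWhen-∈ (child t c) (key t c) (localTrie t)
            (∧-intro meets (within⁺ v refl refl)) key-unique

        lookup-child-∉ : meetsBall t x ≡ false →
          lookupKey (key t c x) (tabulateWhen (child t c) (λ ℓ → key t c ℓ , localTrie t ℓ)) ≡ nothing
        lookup-child-∉ misses = lookupKey-tabulateWhen-∉ (child t c) (key t c) (localTrie t) λ ℓ cℓ eq →
          contradiction (trans (sym misses) (subst (λ a → meetsBall t a ≡ true) (key-unique ℓ cℓ eq)
                                                   (∧-conicalˡ (meetsBall t ℓ) _ cℓ))) λ ()

        misses⇒∉R : meetsBall t x ≡ false → rel S (suc t) u v ≡ false
        misses⇒∉R misses = ¬-not λ uv∈R → contradiction (trans (sym misses)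
          (anyF⁺ _ v (∧-intro (inBall-neighbour (rel S (suc t)) uv∈R) (⌊⌋-true (x ≟ x) refl)))) λ ()

      -- If v's part at level t misses the ball then uv ∉ R_{t+1}, and homogeneity of P_{t+1}
      -- modulo R_{t+1} makes the bit of the parent node correct.
      query-localTrie : ∀ {v} → u ≢ v → ∀ t → t < len S →
                        query (localTrie t (part S t v)) (path t v) ≡ adj G u v
      query-localTrie u≢v zero _ = adjModulo-correct G (singletons-homogeneous G (first-singletons S)) u≢v refl
      query-localTrie {v} u≢v (suc t) st<len with meetsBall t (part S t v) in meets
      ... | true  = trans (cong (maybe′ (λ τ → query τ (path t v)) _) (lookup-child-∈ v st<len meets))
                          (query-localTrie u≢v t (<-trans (n<1+n t) st<len))
      ... | false = trans (cong (maybe′ (λ τ → query τ (path t v)) _) (lookup-child-∉ v st<len meets))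
                          (adjModulo-correct G (homogeneous S (suc t) st<len) u≢v (misses⇒∉R v st<len meets))

      keys-localTrie : ∀ t c → KeysAtMost w (localTrie t c)
      keys-localTrie zero c = tt
      keys-localTrie (suc t) c =
        All-tabulateWhen (child t c) _ (λ ℓ _ → ≤-reflexive (length-binary w _) , keys-localTrie t ℓ)

      ballPartsWithin : ℕ → ℕ → Fin n → ℕ
      ballPartsWithin s t c = countF (λ ℓ → meetsBall s ℓ ∧ within s t c ℓ)

      ballPartsWithin-≤ : ∀ {k} → WidthAtMost S 1 k →
                          ∀ {s} t c → suc s < len S → ballPartsWithin s t c ≤ k
      ballPartsWithin-≤ width {s} t c ss<len =
        ≤-trans (countF-mono _ (meetsBall s) (λ ℓ → ∧-conicalˡ (meetsBall s ℓ) _)) (width s ss<len u)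

      -- The level-s parts below distinct children of c are disjoint, and all of them lie below c.
      ∑-children-ballPartsWithin : ∀ {s t} c → s ≤ t → suc t < len S →
        ∑[ ℓ < n ] (if child t c ℓ then ballPartsWithin s t ℓ else 0) ≤ ballPartsWithin s (suc t) c
      ∑-children-ballPartsWithin {s} {t} c s≤t st<len = begin
        ∑[ ℓ < n ] (if child t c ℓ then ballPartsWithin s t ℓ else 0)
          ≡⟨ sum-cong-≗ (λ ℓ → if-countF (child t c ℓ) (λ x → meetsBall s x ∧ within s t ℓ x)) ⟩
        ∑[ ℓ < n ] countF (W ℓ)
          ≤⟨ ∑-countF-disjoint W disjoint ⟩
        countF (λ x → anyF (λ ℓ → W ℓ x))
          ≤⟨ countF-mono _ (λ x → meetsBall s x ∧ within s (suc t) c x) covered ⟩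
        ballPartsWithin s (suc t) c ∎
        where
        open ≤-Reasoning
        W : Fin n → Fin n → Bool
        W ℓ x = child t c ℓ ∧ meetsBall s x ∧ within s t ℓ x
        within-of : ∀ {ℓ x} → W ℓ x ≡ true → within s t ℓ x ≡ true
        within-of {ℓ} {x} e = ∧-conicalʳ (meetsBall s x) _ (∧-conicalʳ (child t c ℓ) _ e)
        disjoint : ∀ ℓ ℓ′ x → W ℓ x ≡ true → W ℓ′ x ≡ true → ℓ ≡ ℓ′
        disjoint ℓ ℓ′ x wℓ wℓ′ =
          within-unique s≤t (<-trans (n<1+n t) st<len) (within-of wℓ) (within-of wℓ′)
        covered : ∀ x → anyF (λ ℓ → W ℓ x) ≡ true → (meetsBall s x ∧ within s (suc t) c x) ≡ true
        covered x w with anyF⁻ (λ ℓ → W ℓ x) w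
        ... | ℓ , wℓ = ∧-intro (∧-conicalˡ (meetsBall s x) _ (∧-conicalʳ (child t c ℓ) _ wℓ))
                         (within-trans s≤t (n≤1+n t) st<len (within-of wℓ)
                                       (∧-conicalʳ (meetsBall t ℓ) _ (∧-conicalˡ (child t c ℓ) _ wℓ)))

      size-localTrie : ∀ t c → t < len S → size (localTrie t c) ≤ sumBelow t (λ s → ballPartsWithin s t c)
      size-localTrie zero c _ = z≤n
      size-localTrie (suc t) c st<len = begin
        size (localTrie (suc t) c)
          ≡⟨ sum-map-tabulateWhen (child t c) (λ ℓ → key t c ℓ , localTrie t ℓ)
                                  (λ (_ , τ) → suc (size τ)) ⟩
        ∑[ ℓ < n ] (if child t c ℓ then suc (size (localTrie t ℓ)) else 0)
          ≤⟨ ∑-mono-≤ (λ ℓ → if-mono-≤ (child t c ℓ)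
                                (s≤s (size-localTrie t ℓ (<-trans (n<1+n t) st<len)))) ⟩
        ∑[ ℓ < n ] (if child t c ℓ then suc (sumBelow t (λ s → ballPartsWithin s t ℓ)) else 0)
          ≡⟨ sum-cong-≗ (λ ℓ → if-suc-sumBelow (child t c ℓ) {t} (λ s → ballPartsWithin s t ℓ)) ⟩
        ∑[ ℓ < n ] (ind ℓ + sumBelow t (λ s → guarded s ℓ))
          ≡⟨ ∑-distrib-+ ind (λ ℓ → sumBelow t (λ s → guarded s ℓ)) ⟩
        ∑[ ℓ < n ] ind ℓ + ∑[ ℓ < n ] sumBelow t (λ s → guarded s ℓ)
          ≡⟨ cong₂ _+_ (sym (countF≡∑ (child t c))) (∑-sumBelow-comm t guarded) ⟩
        countF (child t c) + sumBelow t (λ s → ∑[ ℓ < n ] guarded s ℓ)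
          ≤⟨ +-monoʳ-≤ (countF (child t c))
               (sumBelow-mono-≤ t (λ s s<t → ∑-children-ballPartsWithin c (<⇒≤ s<t) st<len)) ⟩
        countF (child t c) + sumBelow t (λ s → ballPartsWithin s (suc t) c) ∎
        where
        open ≤-Reasoning
        ind : Fin n → ℕ
        ind ℓ = if child t c ℓ then 1 else 0
        guarded : ℕ → Fin n → ℕ
        guarded s ℓ = if child t c ℓ then ballPartsWithin s t ℓ else 0

-- Short labellings from a merge sequence

module MergeLabelling {n} {G : Graph n} (S : MergeSeq G) {Δ} (valency : ValencyAtMost S Δ) where
  open Hierarchy S
  open Coding valency

  T : ℕ
  T = len S ∸ 1

  T<len : T < len S
  T<len = ≤-reflexive (trans (+-comm 1 T) (m∸n+n≡m (len≥1 S)))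

  localTrieOf : Fin n → Trie T
  localTrieOf u = Neighbourhood.localTrie u T (part S T u)

  labelOf : Fin n → Word
  labelOf u = encode label (path T u , T , localTrieOf u)

  labelOf-represents : Represents G labelOf
  labelOf-represents u v u≢v = sym (begin
    decideAdjacency (labelOf u) (labelOf v)
      ≡⟨ decideAdjacency-encode (path T u) T (localTrieOf u) (path T v) (T , localTrieOf v) ⟩
    query (localTrieOf u) (path T v)
      ≡⟨ cong (λ c → query (Neighbourhood.localTrie u T c) (path T v)) (last-whole S u v) ⟩
    query (Neighbourhood.localTrie u T (part S T v)) (path T v)
      ≡⟨ Neighbourhood.query-localTrie u u≢v T T<len ⟩
    adj G u v ∎)
    where open ≡-Reasoning

  labelOf-length : ∀ {k} → WidthAtMost S 1 k → ∀ u →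
    length (labelOf u) ≤ suc (T * (2 + w * 2)) + (suc T + (2 + (2 * w + 4) * (T * k)))
  labelOf-length {k} width u = begin
    length (encode (list word) (path T u) ++ encode unary T ++ encode (trie T) (localTrieOf u))
      ≡⟨ List.length-++ (encode (list word) (path T u)) ⟩
    length (encode (list word) (path T u)) + length (encode unary T ++ encode (trie T) (localTrieOf u))
      ≡⟨ cong (length (encode (list word) (path T u)) +_) (List.length-++ (encode unary T)) ⟩
    length (encode (list word) (path T u)) + (length (encode unary T) + length (encode (trie T) (localTrieOf u)))
      ≤⟨ +-mono-≤ path-bound (+-mono-≤ (≤-reflexive (length-encode-unary T)) trie-bound) ⟩
    suc (T * (2 + w * 2)) + (suc T + (2 + (2 * w + 4) * (T * k))) ∎
    where
    open ≤-Reasoning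
    path-bound : length (encode (list word) (path T u)) ≤ suc (T * (2 + w * 2))
    path-bound = begin
      length (encode (list word) (path T u))
        ≤⟨ length-encode-list≤ word (λ _ → suc (w * 2))
                               (All.map (λ {c} → length-encode-word≤ c) (path-keys T u)) ⟩
      suc (sum (map (λ _ → 2 + w * 2) (path T u)))
        ≡⟨ cong suc (trans (sum-map-const (2 + w * 2) (path T u)) (cong (_* (2 + w * 2)) (length-path T u))) ⟩
      suc (T * (2 + w * 2)) ∎
    size-bound : size (localTrieOf u) ≤ T * k
    size-bound = begin
      size (localTrieOf u)
        ≤⟨ Neighbourhood.size-localTrie u T (part S T u) T<len ⟩
      sumBelow T (λ s → Neighbourhood.ballPartsWithin u s T (part S T u))
        ≤⟨ sumBelow-mono-≤ T (λ s s<T →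
             Neighbourhood.ballPartsWithin-≤ u width T _ (≤-trans (s≤s s<T) T<len)) ⟩
      sumBelow T (λ _ → k)
        ≡⟨ sumBelow-const T k ⟩
      T * k ∎
    trie-bound : length (encode (trie T) (localTrieOf u)) ≤ 2 + (2 * w + 4) * (T * k)
    trie-bound = ≤-trans (length-encode-trie w (localTrieOf u) (Neighbourhood.keys-localTrie u T _))
                         (+-monoʳ-≤ 2 (*-monoʳ-≤ (2 * w + 4) size-bound))

-- The added polynomial is the coefficient-wise difference of both sides, written in T, a = w - 1
-- and b = k - 1.
label-arithmetic : ∀ T m k w → suc T ≤ m → 1 ≤ k → 1 ≤ w →
  suc (T * (2 + w * 2)) + (suc T + (2 + (2 * w + 4) * (T * k))) ≤ 11 * (m * k * w)
label-arithmetic T m (suc b) (suc a) T<m _ _ = begin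
  suc (T * (2 + suc a * 2)) + (suc T + (2 + (2 * suc a + 4) * (T * suc b)))
    ≤⟨ m≤m+n _ (9 * a * b * T + 7 * a * T + 5 * b * T + 11 * a * b + 11 * a + 11 * b + 7) ⟩
  suc (T * (2 + suc a * 2)) + (suc T + (2 + (2 * suc a + 4) * (T * suc b)))
    + (9 * a * b * T + 7 * a * T + 5 * b * T + 11 * a * b + 11 * a + 11 * b + 7)
    ≡⟨ expand T a b ⟩
  11 * (suc T * (suc b * suc a))  ≤⟨ *-monoʳ-≤ 11 (*-monoˡ-≤ (suc b * suc a) T<m) ⟩
  11 * (m * (suc b * suc a))      ≡⟨ cong (11 *_) (*-assoc m (suc b) (suc a)) ⟨
  11 * (m * suc b * suc a)        ∎
  where
  open ≤-Reasoning
  expand : ∀ T a b → suc (T * (2 + suc a * 2)) + (suc T + (2 + (2 * suc a + 4) * (T * suc b)))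
             + (9 * a * b * T + 7 * a * T + 5 * b * T + 11 * a * b + 11 * a + 11 * b + 7)
           ≡ 11 * (suc T * (suc b * suc a))
  expand = solve-∀

short-representation : ∀ {n} {G : Graph n} (S : MergeSeq G) {m Δ k} →
  len S ≤ m → ValencyAtMost S Δ → WidthAtMost S 1 k → ShortRepresentation (11 * (m * k * ⌈log₂ Δ ⌉)) G
short-representation {zero} {G} S _ _ _ = (λ _ → []) , (λ _ → z≤n) , trivial-representation G λ ()
short-representation {suc zero} {G} S _ _ _ =
  (λ _ → []) , (λ _ → z≤n) , trivial-representation G λ { F.zero F.zero → refl }
short-representation {suc (suc n)} {G} S {m} {Δ} {k} len≤m valency width =
  labelOf , short , labelOf-represents
  where
  open MergeLabelling S valency
  open Hierarchy S using (collapse; 2≤len)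
  0≢1 : F.zero ≢ F.suc F.zero
  0≢1 ()
  2≤Δ : 2 ≤ Δ
  2≤Δ = ≰⇒> λ Δ≤1 → 0≢1 (collapse valency Δ≤1 _ _)
  ball₀ : Fin (suc (suc n)) → Bool
  ball₀ ℓ = anyF (λ x → inBall (rel S 1) 1 F.zero x ∧ ⌊ part S 0 x ≟ ℓ ⌋)
  centre-counted : ball₀ (part S 0 F.zero) ≡ true
  centre-counted = anyF⁺ (λ x → inBall (rel S 1) 1 F.zero x ∧ ⌊ part S 0 x ≟ part S 0 F.zero ⌋) F.zero
    (∧-intro (inBall-centre (rel S 1) 1 F.zero) (⌊⌋-true (part S 0 F.zero ≟ part S 0 F.zero) refl))
  1≤k : 1 ≤ k
  1≤k = ≤-trans (countF>0 ball₀ (part S 0 F.zero) centre-counted) (width 0 (2≤len 0≢1) F.zero)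
  short : ∀ u → length (labelOf u) ≤ 11 * (m * k * ⌈log₂ Δ ⌉)
  short u = ≤-trans (labelOf-length width u)
                    (label-arithmetic T m k ⌈log₂ Δ ⌉ (≤-trans T<len len≤m) 1≤k (⌈log₂⌉-mono-≤ 2≤Δ))

-- Encoding by exhaustive search

words : ℕ → List Word
words zero = [] ∷ []
words (suc b) = [] ∷ cartesianProductWith _∷_ (true ∷ false ∷ []) (words b)

words-complete : ∀ {b} c → length c ≤ b → c ∈ words b
words-complete {zero} [] _ = here refl
words-complete {suc b} [] _ = here refl
words-complete {suc b} (x ∷ c) (s≤s c≤b) =
  there (∈-cartesianProductWith⁺ _∷_ (bit∈ x) (words-complete c c≤b))
  where
  bit∈ : ∀ x → x ∈ true ∷ false ∷ []
  bit∈ true = here refl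
  bit∈ false = there (here refl)

labellings : ∀ n → ℕ → List (Vec Word n)
labellings zero b = [] ∷ []
labellings (suc n) b = cartesianProductWith _∷_ (words b) (labellings n b)

labellings-complete : ∀ {n b} (ℓ : Vec Word n) →
                      (∀ u → length (Vec.lookup ℓ u) ≤ b) → ℓ ∈ labellings n b
labellings-complete [] _ = here refl
labellings-complete (c ∷ ℓ) short =
  ∈-cartesianProductWith⁺ _∷_ (words-complete c (short F.zero)) (labellings-complete ℓ (short ∘ F.suc))

Represents? : ∀ {n} (G : Graph n) f → Dec (Represents G f)
Represents? G f =
  FP.all? λ u → FP.all? λ v → ¬? (u ≟ v) →-dec (adj G u v Bool.≟ decideAdjacency (f u) (f v))

module Search (B : ℕ → ℕ) where

  Good : ∀ {n} → Graph n → Vec Word n → Set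
  Good {n} G ℓ = (∀ u → length (Vec.lookup ℓ u) ≤ B n) × Represents G (Vec.lookup ℓ)

  Good? : ∀ {n} (G : Graph n) ℓ → Dec (Good G ℓ)
  Good? {n} G ℓ = FP.all? (λ u → length (Vec.lookup ℓ u) ≤? B n) ×-dec Represents? G (Vec.lookup ℓ)

  pick : ∀ {n} (G : Graph n) {ℓs} → Dec (Any (Good G) ℓs) → Fin n → Word
  pick G (yes found) = Vec.lookup (proj₁ (satisfied found))
  pick G (no _) _ = []

  search : ∀ {n} (G : Graph n) → Dec (Any (Good G) (labellings n (B n)))
  search {n} G = any? (Good? G) (labellings n (B n))

  length-pick : ∀ {n} (G : Graph n) {ℓs} (d : Dec (Any (Good G) ℓs)) u → length (pick G d u) ≤ B n
  length-pick G (yes found) = proj₁ (proj₂ (satisfied found))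
  length-pick G (no _) _ = z≤n

  pick-represents : ∀ {n} (G : Graph n) {ℓs} → Any (Good G) ℓs → (d : Dec (Any (Good G) ℓs)) →
                    Represents G (pick G d)
  pick-represents G _ (yes found) = proj₂ (proj₂ (satisfied found))
  pick-represents G found (no none) = contradiction found none

  search-represents : ∀ {n} (G : Graph n) → ShortRepresentation (B n) G → Represents G (pick G (search G))
  search-represents {n} G (f , short , represents) =
    pick-represents G (lose (labellings-complete (Vec.tabulate f) short′) (short′ , represents′)) (search G)
    where
    short′ : ∀ u → length (Vec.lookup (Vec.tabulate f) u) ≤ B n
    short′ u = subst (λ c → length c ≤ B n) (sym (Vec.lookup∘tabulate f u)) (short u)
    represents′ : Represents G (Vec.lookup (Vec.tabulate f))
    represents′ u v u≢v = trans (represents u v u≢v)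
      (sym (cong₂ decideAdjacency (Vec.lookup∘tabulate f u) (Vec.lookup∘tabulate f v)))

  searchScheme : (C : GraphClass) →
    (∀ n (G : Graph n) → C G → ShortRepresentation (B n) G) →
    LabellingScheme C
  searchScheme C short = record
    { encoder = λ G → pick G (search G)
    ; decoder = decideAdjacency
    ; correct = λ {n} G inC u v u≢v →
        let adj≡ = search-represents G (short n G inC) u v u≢v in mk⇔ (trans (sym adj≡)) (trans adj≡)
    }

theorem8p9 : (C : GraphClass) (m Δ k : ℕ → ℕ) →
    (∀ n (G : Graph n) → C G →
      Σ (MergeSeq G) (λ S → len S ≤ m n × ValencyAtMost S (Δ n) × WidthAtMost S 1 (k n))) →
    Σ (LabellingScheme C) (λ L → LengthBigO L (λ n → m n * k n * ⌈log₂ Δ n ⌉))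
theorem8p9 C m Δ k mergeable = searchScheme C short , 11 , 0 , λ n _ G _ → length-pick G (search G)
  where
  B : ℕ → ℕ
  B n = 11 * (m n * k n * ⌈log₂ Δ n ⌉)
  open Search B
  short : ∀ n (G : Graph n) → C G → ShortRepresentation (B n) G
  short n G inC =
    let S , len≤m , valency , width = mergeable n G inC in short-representation S len≤m valency width
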